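{- Let $m,h$ be positive integers and $k\ge2$ an integer. Then $\mathrm{capt}_{\zeta,k}(\mathcal{T}_m^h)\ge h\left\lfloor\frac{m-1}{k}\right\rfloor$.
   Context: The perfect $m$-ary tree $\mathcal{T}_m^h$ of height $h$ is the rooted tree with levels $0,1,\dots,h$, where level $0$ is the root, and every vertex in levels $0,\dots,h-1$ has exactly $m$ children in the next level (so level $i$ has $m^i$ vertices, all at distance $i$ from the root). The localization game on a connected graph $G$ with $k$ cops: the robber, invisible to the cops, first chooses a starting vertex. In each round the cops choose a multiset of vertices $u_1,\dots,u_k$ (no adjacency restriction) and learn the distances $d(u_i,R)$ to the robber's current vertex $R$; the cops capture the robber if, from all information so far, they can determine the robber's vertex uniquely. If not captured, the robber moves to a neighbor or stays. The robber is omniscient. The localization number $\zeta(G)$ is the least number of cops guaranteeing capture (trees have $\zeta\le2$). For $k\ge\zeta(G)$, $\mathrm{capt}_{\zeta,k}(G)$ is the minimum number of rounds in which $k$ cops can guarantee capture under optimal play. -}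

module Defs where

open import Data.Nat using (ℕ; zero; suc; _+_; _*_; _∸_; _≤_; _<_)
open import Data.Fin using (Fin)
open import Data.Fin.Properties using (_≟_)
open import Data.List using (List; []; _∷_; length; _++_; [_])
open import Data.Vec using (Vec; map)
open import Data.Product using (Σ; ∃; _×_; _,_; proj₁)
open import Data.Sum using (_⊎_)
open import Relation.Nullary using (yes; no)
open import Relation.Binary.PropositionalEquality using (_≡_)

-- The perfect m-ary tree T_m^h.
-- A vertex is the path from the root, i.e. a list of child indices
-- (each in Fin m) of length at most h; its level is the list length.

TVertex : ℕ → ℕ → Set
TVertex m h = Σ (List (Fin m)) (λ p → length p ≤ h)

TAdj : ∀ {m h} → TVertex m h → TVertex m h → Set
TAdj {m} u v =
  (Σ (Fin m) λ c → proj₁ v ≡ proj₁ u ++ [ c ]) ⊎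
  (Σ (Fin m) λ c → proj₁ u ≡ proj₁ v ++ [ c ])

-- length of the longest common prefix (= level of the meet of u and v)
lcpLen : ∀ {m} → List (Fin m) → List (Fin m) → ℕ
lcpLen (a ∷ as) (b ∷ bs) with a ≟ b
... | yes _ = suc (lcpLen as bs)
... | no  _ = zero
lcpLen _ _ = zero

TDist : ∀ {m h} → TVertex m h → TVertex m h → ℕ
TDist u v = length (proj₁ u) + length (proj₁ v) ∸ 2 * lcpLen (proj₁ u) (proj₁ v)

module Game (V : Set) (Adj : V → V → Set) (dist : V → V → ℕ) (k : ℕ) where

  History : Set
  History = List (Vec ℕ k)

  -- a (deterministic, adaptive) cop strategy: the k probed vertices
  -- of the next round as a function of the history so far
  Strategy : Set
  Strategy = History → Vec V k

  -- a robber trajectory: position at round r (rounds indexed from 0);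
  -- between rounds the robber moves to a neighbour or stays
  IsWalk : (ℕ → V) → Set
  IsWalk w = ∀ n → Adj (w n) (w (suc n)) ⊎ w n ≡ w (suc n)

  hist : Strategy → (ℕ → V) → ℕ → History
  hist σ w zero = []
  hist σ w (suc r) =
    hist σ w r ++ [ map (λ u → dist u (w r)) (σ (hist σ w r)) ]

  -- the robber following w is captured in round r (0-indexed): every
  -- robber walk producing the same information in rounds 0..r is at the
  -- same vertex at round r
  CapturedAt : Strategy → (ℕ → V) → ℕ → Set
  CapturedAt σ w r =
    ∀ w' → IsWalk w' → hist σ w' (suc r) ≡ hist σ w (suc r) → w' r ≡ w r

  CanCaptureWithin : ℕ → Set
  CanCaptureWithin t =
    Σ Strategy λ σ → ∀ w → IsWalk w → ∃ λ r → r < t × CapturedAt σ w r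

TreeCanCaptureWithin : (m h k t : ℕ) → Set
TreeCanCaptureWithin m h k t =
  Game.CanCaptureWithin (TVertex m h) (TAdj {m} {h}) (TDist {m} {h}) k t

-- The robber walks down one root-to-leaf path, staying Q = ⌊(m−1)/k⌋ rounds on each level
-- (one round less on level 1). While it sits in a child of a vertex P, the distance from a
-- probe u to that child is the same for every child of P except the one above u, so the cops
-- can only tell apart the children of P that some probe has entered. The strategy is
-- deterministic and the robber omniscient, so the robber fixes its path in advance, choosing
-- the child of P after seeing the probes of its whole stay below P: these enter at most
-- Qk − 1 ≤ m − 2 children (the first probe is dodged by the choice made one level up). Another
-- child of P that no probe entered hosts a decoy with the same observations, so the robber is
-- not caught in the first hQ − 1 rounds.
module Submission where

open import Defs
open import Data.Nat
  using (ℕ; zero; suc; _+_; _*_; _∸_; _/_; _≤_; _<_; _≤?_; z≤n; s≤s; z<s; NonZero)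
open import Data.Nat.Properties hiding (_≟_)
open import Data.Nat.DivMod using (m<n*o⇒m/o<n; /-monoˡ-≤; m*n/n≡m; m/n*n≤m)
open import Data.Fin using (Fin)
open import Data.Fin.Properties using (_≟_; ¬∀⟶∃¬; pigeonhole) renaming (<⇒≢ to <⇒≢ᶠ)
open import Data.Maybe using (Maybe; just; nothing)
open import Data.Maybe.Properties using (just-injective)
open import Data.List using (List; []; _∷_; length; _++_; [_]; _∷ʳ_; take; lookup)
open import Data.List.Properties
  using (length-++; ++-assoc; ++-identityʳ; length-++-≤ˡ; length-take; take-all; take-take;
         ∷ʳ-injectiveʳ)
open import Data.List.Membership.Propositional using (_∈_; _∉_)
open import Data.List.Membership.Propositional.Properties using (∈-++⁺ˡ; ∈-++⁺ʳ)
import Data.List.Membership.DecPropositional as DecMembership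
open import Data.List.Relation.Unary.Any using (here; there; index)
open import Data.List.Relation.Unary.Any.Properties using (lookup-index)
open import Data.Vec using (Vec; []; _∷_) renaming (map to mapᵥ)
open import Data.Product using (Σ; ∃; _×_; _,_; proj₁; proj₂)
open import Data.Sum using (_⊎_; inj₁; inj₂)
open import Function using (_∘_)
open import Relation.Nullary using (¬_; yes; no; Dec; contradiction)
open import Relation.Binary.PropositionalEquality hiding ([_])

module _ {A : Set} where

  take-++ˡ : ∀ n (xs ys : List A) → n ≤ length xs → take n (xs ++ ys) ≡ take n xs
  take-++ˡ zero    xs       ys _          = refl
  take-++ˡ (suc n) (x ∷ xs) ys (s≤s n≤xs) = cong (x ∷_) (take-++ˡ n xs ys n≤xs)

  take-length-++ : ∀ (xs ys : List A) → take (length xs) (xs ++ ys) ≡ xs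
  take-length-++ xs ys =
    trans (take-++ˡ (length xs) xs ys ≤-refl) (take-all (length xs) xs ≤-refl)

  take-take-≤ : ∀ {n j} (xs : List A) → n ≤ j → take n (take j xs) ≡ take n xs
  take-take-≤ {n} {j} xs n≤j =
    trans (take-take n j xs) (cong (λ i → take i xs) (m≤n⇒m⊓n≡m n≤j))

  length-take-≤ : ∀ n (xs : List A) → length (take n xs) ≤ length xs
  length-take-≤ n xs = ≤-trans (≤-reflexive (length-take n xs)) (m⊓n≤n n (length xs))

  take-suc-≡⊎∷ʳ : ∀ n (xs : List A) →
    take (suc n) xs ≡ take n xs ⊎ ∃ λ c → take (suc n) xs ≡ take n xs ∷ʳ c
  take-suc-≡⊎∷ʳ zero    []       = inj₁ refl
  take-suc-≡⊎∷ʳ zero    (x ∷ xs) = inj₂ (x , refl)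
  take-suc-≡⊎∷ʳ (suc n) []       = inj₁ refl
  take-suc-≡⊎∷ʳ (suc n) (x ∷ xs) with take-suc-≡⊎∷ʳ n xs
  ... | inj₁ same       = inj₁ (cong (x ∷_) same)
  ... | inj₂ (c , next) = inj₂ (c , cong (x ∷_) next)

  length-∷ʳ : ∀ (xs : List A) x → length (xs ∷ʳ x) ≡ suc (length xs)
  length-∷ʳ xs x = trans (length-++ xs) (+-comm (length xs) 1)

module _ {m : ℕ} where
  open DecMembership (_≟_ {m}) using (_∈?_)

  ∃∉ : (xs : List (Fin m)) → length xs < m → ∃ λ c → c ∉ xs
  ∃∉ xs xs<m = ¬∀⟶∃¬ m (_∈ xs) (_∈? xs) covering⇒⊥
    where
    covering⇒⊥ : ¬ (∀ c → c ∈ xs)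
    covering⇒⊥ all∈ with i , j , i<j , same ← pigeonhole xs<m (λ c → index (all∈ c)) =
      <⇒≢ᶠ i<j (trans (lookup-index (all∈ i))
                      (trans (cong (lookup xs) same) (sym (lookup-index (all∈ j)))))

  ∃∉-≢ : (xs : List (Fin m)) (y : Fin m) → 2 + length xs ≤ m → ∃ λ z → z ≢ y × z ∉ xs
  ∃∉-≢ xs y room = proj₁ other , proj₂ other ∘ here , proj₂ other ∘ there
    where
    other = ∃∉ (y ∷ xs) room

Path : ℕ → Set
Path m = List (Fin m)

module _ {m : ℕ} where

  pathDist : Path m → Path m → ℕ
  pathDist u v = length u + length v ∸ 2 * lcpLen u v

  childToward : Path m → Path m → Maybe (Fin m)
  childToward []      []      = nothing
  childToward []      (a ∷ u) = just a
  childToward (_ ∷ _) []      = nothing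
  childToward (x ∷ P) (a ∷ u) with a ≟ x
  ... | yes _ = childToward P u
  ... | no  _ = nothing

  offBranchDist : Path m → Path m → ℕ
  offBranchDist P u = length u + (length P + 1) ∸ 2 * lcpLen u P

  lcpLen-∷ʳ : ∀ P u c → childToward P u ≢ just c → lcpLen u (P ∷ʳ c) ≡ lcpLen u P
  lcpLen-∷ʳ []      []      _ _ = refl
  lcpLen-∷ʳ []      (a ∷ u) c c≢ with a ≟ c
  ... | yes a≡c = contradiction (cong just a≡c) c≢
  ... | no  _   = refl
  lcpLen-∷ʳ (_ ∷ _) []      _ _ = refl
  lcpLen-∷ʳ (x ∷ P) (a ∷ u) c c≢ with a ≟ x
  ... | yes _ = cong suc (lcpLen-∷ʳ P u c c≢)
  ... | no  _ = refl

  pathDist-off-branch : ∀ P u c → childToward P u ≢ just c →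
    pathDist u (P ∷ʳ c) ≡ offBranchDist P u
  pathDist-off-branch P u c c≢ rewrite length-++ P {[ c ]} | lcpLen-∷ʳ P u c c≢ = refl

  childToward-∷ʳ : ∀ P u {a b} → childToward (P ∷ʳ a) u ≡ just b → childToward P u ≡ just a
  childToward-∷ʳ []      (x ∷ u) {a} eq with x ≟ a
  childToward-∷ʳ []      (x ∷ u) _  | yes x≡a = cong just x≡a
  childToward-∷ʳ []      (x ∷ u) () | no  _
  childToward-∷ʳ (p ∷ P) (x ∷ u)     eq with x ≟ p
  ... | yes _ = childToward-∷ʳ P u eq

module _ {m h : ℕ} where

  probedChildren : ∀ {n} → Path m → Vec (TVertex m h) n → Path m
  probedChildren P []      = []
  probedChildren P (u ∷ V) with childToward P (proj₁ u)
  ... | just c  = c ∷ probedChildren P V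
  ... | nothing = probedChildren P V

  length-probedChildren : ∀ {n} P (V : Vec (TVertex m h) n) → length (probedChildren P V) ≤ n
  length-probedChildren P []      = z≤n
  length-probedChildren P (u ∷ V) with childToward P (proj₁ u)
  ... | just _  = s≤s (length-probedChildren P V)
  ... | nothing = m≤n⇒m≤1+n (length-probedChildren P V)

  length-probedChildren-skip : ∀ {n} P u (V : Vec (TVertex m h) n) →
    childToward P (proj₁ u) ≡ nothing → length (probedChildren P (u ∷ V)) ≤ n
  length-probedChildren-skip P u V toward with childToward P (proj₁ u)
  length-probedChildren-skip P u V refl | nothing = length-probedChildren P V

  dists-to-unprobed-child : ∀ {n} P c (V : Vec (TVertex m h) n) → c ∉ probedChildren P V →
    mapᵥ (λ u → pathDist (proj₁ u) (P ∷ʳ c)) V ≡ mapᵥ (λ u → offBranchDist P (proj₁ u)) V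
  dists-to-unprobed-child P c []      _  = refl
  dists-to-unprobed-child P c (u ∷ V) c∉ with childToward P (proj₁ u) in toward
  ... | just _  = cong₂ _∷_ (pathDist-off-branch P (proj₁ u) c c≢)
                            (dists-to-unprobed-child P c V (c∉ ∘ there))
    where
    c≢ : childToward P (proj₁ u) ≢ just c
    c≢ toward-c = c∉ (here (sym (just-injective (trans (sym toward) toward-c))))
  ... | nothing = cong₂ _∷_ (pathDist-off-branch P (proj₁ u) c c≢)
                            (dists-to-unprobed-child P c V c∉)
    where
    c≢ : childToward P (proj₁ u) ≢ just c
    c≢ toward-c = contradiction (trans (sym toward) toward-c) λ ()

  -- The first probe lies below at most one of two distinct children of P.
  lightly-probed-child : ∀ {n} P (Good : Fin m → Set) {c₁ c₂} →
    Good c₁ → Good c₂ → c₁ ≢ c₂ → (V : Vec (TVertex m h) (suc n)) →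
    ∃ λ y → Good y × length (probedChildren (P ∷ʳ y) V) ≤ n
  lightly-probed-child P _ {c₁} {c₂} good₁ good₂ c₁≢c₂ (u ∷ V)
    with childToward (P ∷ʳ c₁) (proj₁ u) in toward₁
  ... | nothing = c₁ , good₁ , length-probedChildren-skip (P ∷ʳ c₁) u V toward₁
  ... | just _ with childToward (P ∷ʳ c₂) (proj₁ u) in toward₂
  ...   | nothing = c₂ , good₂ , length-probedChildren-skip (P ∷ʳ c₂) u V toward₂
  ...   | just _ = contradiction (just-injective (trans (sym (childToward-∷ʳ P (proj₁ u) toward₁))
                                                      (childToward-∷ʳ P (proj₁ u) toward₂)))
                                  c₁≢c₂

-- The robber spends q + 1 rounds on each level, except level 1, which it leaves one round
-- early: round r is spent on level 1 + phase r, and phase a ends before round phaseEnd a.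
module Schedule (q : ℕ) where

  phase : ℕ → ℕ
  phase r = suc r / suc q

  phaseEnd : ℕ → ℕ
  phaseEnd a = q + a * suc q

  phase-≤ : ∀ {r a} → r < phaseEnd a → phase r ≤ a
  phase-≤ {r} {a} r<end = ≤-pred (m<n*o⇒m/o<n {suc r} {suc a} {suc q} (s≤s r<end))

  phase-> : ∀ {r a} → phaseEnd a ≤ r → a < phase r
  phase-> {r} {a} end≤r =
    ≤-trans (≤-reflexive (sym (m*n/n≡m (suc a) (suc q)))) (/-monoˡ-≤ (suc q) (s≤s end≤r))

  <-phaseEnd-phase : ∀ r → r < phaseEnd (phase r)
  <-phaseEnd-phase r with phaseEnd (phase r) ≤? r
  ... | yes end≤r = contradiction (phase-> end≤r) (<-irrefl refl)
  ... | no  end≰r = ≰⇒> end≰r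

  phaseEnd-< : ∀ a → phaseEnd a < phaseEnd (suc a)
  phaseEnd-< a = +-monoʳ-< q (m<n+m (a * suc q) z<s)

  phase-mono : ∀ {r r'} → r ≤ r' → phase r ≤ phase r'
  phase-mono r≤r' = /-monoˡ-≤ (suc q) (s≤s r≤r')

  phase-suc : ∀ r → phase (suc r) ≡ phase r ⊎ phase (suc r) ≡ suc (phase r)
  phase-suc r
    with m≤n⇒m<n∨m≡n (phase-≤ (≤-<-trans (<-phaseEnd-phase r) (phaseEnd-< (phase r))))
  ... | inj₁ stays = inj₁ (≤-antisym (≤-pred stays) (phase-mono (n≤1+n r)))
  ... | inj₂ moves = inj₂ moves

  phase<height : ∀ {r} h → suc (suc r) ≤ h * suc q → phase r < h
  phase<height (suc a) (s≤s r<end) = s≤s (phase-≤ r<end)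

module Evasion {m h k q : ℕ} where
  open Schedule q
  open Game (TVertex m h) (TAdj {m} {h}) (TDist {m} {h}) (suc k)

  level : ℕ → ℕ
  level r = suc (phase r)

  vertex-≡ : {u v : TVertex m h} → proj₁ u ≡ proj₁ v → u ≡ v
  vertex-≡ {_ , u≤h} {_ , v≤h} refl = cong (_ ,_) (≤-irrelevant u≤h v≤h)

  walkAlong : (L : Path m) → length L ≤ h → ℕ → TVertex m h
  walkAlong L L≤h r = take (level r) L , ≤-trans (length-take-≤ (level r) L) L≤h

  walkAlong-isWalk : ∀ L L≤h → IsWalk (walkAlong L L≤h)
  walkAlong-isWalk L L≤h r with phase-suc r
  ... | inj₁ stays = inj₂ (vertex-≡ (cong (λ a → take (suc a) L) (sym stays)))
  ... | inj₂ moves with take-suc-≡⊎∷ʳ (level r) L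
  ...   | inj₁ stuck       =
    inj₂ (vertex-≡ (sym (trans (cong (λ a → take (suc a) L) moves) stuck)))
  ...   | inj₂ (c , child) =
    inj₁ (inj₁ (c , trans (cong (λ a → take (suc a) L) moves) child))

  StaysOn : Path m → ℕ → Set
  StaysOn P R = ∀ r → r < R → level r ≤ length P

  module _ (σ : Strategy) where

    historyAlong : Path m → ℕ → History
    historyAlong L zero    = []
    historyAlong L (suc r) =
      historyAlong L r ∷ʳ
      mapᵥ (λ u → pathDist (proj₁ u) (take (level r) L)) (σ (historyAlong L r))

    hist-walkAlong : ∀ L L≤h r → hist σ (walkAlong L L≤h) r ≡ historyAlong L r
    hist-walkAlong L L≤h zero    = refl
    hist-walkAlong L L≤h (suc r) rewrite hist-walkAlong L L≤h r = refl

    historyAlong-cong : ∀ L L' R → (∀ r → r < R → take (level r) L ≡ take (level r) L') →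
      historyAlong L R ≡ historyAlong L' R
    historyAlong-cong L L' zero    _      = refl
    historyAlong-cong L L' (suc R) agree
      rewrite historyAlong-cong L L' R (λ r r<R → agree r (m<n⇒m<1+n r<R)) | agree R ≤-refl = refl

    -- The observations of the cops while the robber walks along P and then, once below P,
    -- sits in a child of P that no probe has entered (exposed lists the entered children).
    -- They do not depend on which such child it is, so the robber may choose it afterwards.
    blindResponse : ∀ P r → Dec (level r ≤ length P) → Path m → ℕ
    blindResponse P r (yes _) u = pathDist u (take (level r) P)
    blindResponse P r (no  _) u = offBranchDist P u

    blindHistory : Path m → ℕ → History
    blindHistory P zero    = []
    blindHistory P (suc r) =
      blindHistory P r ∷ʳ
      mapᵥ (λ u → blindResponse P r (level r ≤? length P) (proj₁ u)) (σ (blindHistory P r))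

    exposedAt : ∀ P r → Dec (level r ≤ length P) → Path m
    exposedAt P r (yes _) = []
    exposedAt P r (no  _) = probedChildren P (σ (blindHistory P r))

    exposed : Path m → ℕ → Path m
    exposed P zero    = []
    exposed P (suc r) = exposed P r ++ exposedAt P r (level r ≤? length P)

    response-unexposed : ∀ P c r (d : Dec (level r ≤ length P)) → c ∉ exposedAt P r d →
      mapᵥ (λ u → pathDist (proj₁ u) (take (level r) (P ∷ʳ c))) (σ (blindHistory P r))
        ≡ mapᵥ (λ u → blindResponse P r d (proj₁ u)) (σ (blindHistory P r))
    response-unexposed P c r (yes on) _ =
      cong dists-to (take-++ˡ (level r) P [ c ] on)
      where
      dists-to = λ L → mapᵥ (λ u → pathDist (proj₁ u) L) (σ (blindHistory P r))
    response-unexposed P c r (no off) c∉ =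
      trans (cong dists-to (take-all (level r) (P ∷ʳ c) short))
            (dists-to-unprobed-child P c (σ (blindHistory P r)) c∉)
      where
      dists-to = λ L → mapᵥ (λ u → pathDist (proj₁ u) L) (σ (blindHistory P r))
      short : length (P ∷ʳ c) ≤ level r
      short = subst (_≤ level r) (sym (length-∷ʳ P c)) (≰⇒> off)

    historyAlong-unexposed : ∀ P c r → c ∉ exposed P r →
      historyAlong (P ∷ʳ c) r ≡ blindHistory P r
    historyAlong-unexposed P c zero    _  = refl
    historyAlong-unexposed P c (suc r) c∉ rewrite historyAlong-unexposed P c r (c∉ ∘ ∈-++⁺ˡ) =
      cong (λ obs → blindHistory P r ∷ʳ obs)
           (response-unexposed P c r (level r ≤? length P) (c∉ ∘ ∈-++⁺ʳ (exposed P r)))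

    blindHistory-staysOn : ∀ P R → StaysOn P R → blindHistory P R ≡ historyAlong P R
    blindHistory-staysOn P zero    _  = refl
    blindHistory-staysOn P (suc R) on with level R ≤? length P
    ... | yes _ rewrite blindHistory-staysOn P R (λ r r<R → on r (m<n⇒m<1+n r<R)) = refl
    ... | no off = contradiction (on R ≤-refl) off

    exposed-staysOn : ∀ P R → StaysOn P R → exposed P R ≡ []
    exposed-staysOn P zero    _  = refl
    exposed-staysOn P (suc R) on with level R ≤? length P
    ... | yes _ rewrite exposed-staysOn P R (λ r r<R → on r (m<n⇒m<1+n r<R)) = refl
    ... | no off = contradiction (on R ≤-refl) off

    exposedAt-off : ∀ P r → ¬ level r ≤ length P →
      exposedAt P r (level r ≤? length P) ≡ probedChildren P (σ (blindHistory P r))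
    exposedAt-off P r off with level r ≤? length P
    ... | yes on = contradiction on off
    ... | no  _  = refl

    length-exposedAt : ∀ P r d → length (exposedAt P r d) ≤ suc k
    length-exposedAt P r (yes _) = z≤n
    length-exposedAt P r (no  _) = length-probedChildren P (σ (blindHistory P r))

    exposed-+ : ∀ P R d → ∃ λ rest → exposed P (d + R) ≡ exposed P R ++ rest
    exposed-+ P R zero    = [] , sym (++-identityʳ _)
    exposed-+ P R (suc d) with exposed-+ P R d
    ... | rest , grown =
      rest ++ new , trans (cong (_++ new) grown) (++-assoc (exposed P R) rest new)
      where
      new = exposedAt P (d + R) (level (d + R) ≤? length P)

    exposed-mono : ∀ P {R R'} → R ≤ R' → ∃ λ rest → exposed P R' ≡ exposed P R ++ rest
    exposed-mono P {R} {R'} R≤R' = subst (λ n → ∃ λ rest → exposed P n ≡ exposed P R ++ rest)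
                                        (m∸n+n≡m R≤R') (exposed-+ P R (R' ∸ R))

    ∉-exposed-mono : ∀ P {R R' c} → R ≤ R' → c ∉ exposed P R' → c ∉ exposed P R
    ∉-exposed-mono P R≤R' c∉ with exposed-mono P R≤R'
    ... | rest , extends = c∉ ∘ subst (_ ∈_) (sym extends) ∘ ∈-++⁺ˡ

    length-exposed-mono : ∀ P {R R'} → R ≤ R' → length (exposed P R) ≤ length (exposed P R')
    length-exposed-mono P {R} R≤R' with exposed-mono P R≤R'
    ... | rest , extends =
      ≤-trans (length-++-≤ˡ (exposed P R)) (≤-reflexive (cong length (sym extends)))

    length-exposed-+ : ∀ P R d → length (exposed P (d + R)) ≤ length (exposed P R) + d * suc k
    length-exposed-+ P R zero    = ≤-reflexive (sym (+-identityʳ _))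
    length-exposed-+ P R (suc d) = begin
      length (exposed P (d + R) ++ new)    ≡⟨ length-++ (exposed P (d + R)) ⟩
      length (exposed P (d + R)) + length new
        ≤⟨ +-mono-≤ (length-exposed-+ P R d) (length-exposedAt P (d + R) below?) ⟩
      E + d * suc k + suc k                ≡⟨ +-assoc E (d * suc k) (suc k) ⟩
      E + (d * suc k + suc k)              ≡⟨ cong (E +_) (+-comm (d * suc k) (suc k)) ⟩
      E + suc d * suc k                    ∎
      where
      open ≤-Reasoning
      below? = level (d + R) ≤? length P
      new = exposedAt P (d + R) below?
      E = length (exposed P R)

    module _ (room : suc (suc q * suc k) ≤ m) where

      Viable : ℕ → Path m → Set
      Viable a P = length P ≡ a × 2 + length (exposed P (phaseEnd a)) ≤ m

      viable-[] : Viable 0 []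
      viable-[] =
        refl , ≤-trans (s≤s (s≤s (≤-trans (length-exposed-+ [] 0 q) (m≤n+m (q * suc k) k)))) room

      -- The next child is chosen so that the first probe of the following phase does not
      -- enter it: that phase then exposes at most k + q (k + 1) children below it.
      nextChild : ∀ a P → Viable a P → ∃ λ y → y ∉ exposed P (phaseEnd a) ×
        length (probedChildren (P ∷ʳ y) (σ (blindHistory P (phaseEnd a)))) ≤ k
      nextChild a P (_ , free₂) =
        let (c₁ , c₁∉)         = ∃∉ E (<⇒≤ free₂)
            (c₂ , c₂≢c₁ , c₂∉) = ∃∉-≢ E c₁ free₂
        in lightly-probed-child P (_∉ E) c₁∉ c₂∉ (c₂≢c₁ ∘ sym) (σ (blindHistory P end))
        where
        end = phaseEnd a
        E = exposed P end

      viable-∷ʳ : ∀ a P (v : Viable a P) → Viable (suc a) (P ∷ʳ proj₁ (nextChild a P v))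
      viable-∷ʳ a P v@(P≡a , _) = length-P′ , ≤-trans (s≤s (s≤s exposed-next)) room
        where
        y = proj₁ (nextChild a P v)
        P′ = P ∷ʳ y
        end = phaseEnd a

        length-P′ : length P′ ≡ suc a
        length-P′ = trans (length-∷ʳ P y) (cong suc P≡a)

        on-P′ : StaysOn P′ end
        on-P′ r r<end = subst (level r ≤_) (sym length-P′) (s≤s (phase-≤ r<end))

        off-P′ : ¬ level end ≤ length P′
        off-P′ on = <⇒≱ (s≤s (phase-> ≤-refl)) (subst (level end ≤_) length-P′ on)

        same-view : blindHistory P′ end ≡ blindHistory P end
        same-view = trans (blindHistory-staysOn P′ end on-P′)
                          (historyAlong-unexposed P y end (proj₁ (proj₂ (nextChild a P v))))

        exposed-first : length (exposed P′ (suc end)) ≤ k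
        exposed-first = begin
          length (exposed P′ end ++ exposedAt P′ end (level end ≤? length P′))
            ≡⟨ cong (λ E → length (E ++ exposedAt P′ end (level end ≤? length P′)))
                    (exposed-staysOn P′ end on-P′) ⟩
          length (exposedAt P′ end (level end ≤? length P′))
            ≡⟨ cong length (exposedAt-off P′ end off-P′) ⟩
          length (probedChildren P′ (σ (blindHistory P′ end)))
            ≡⟨ cong (λ H → length (probedChildren P′ (σ H))) same-view ⟩
          length (probedChildren P′ (σ (blindHistory P end)))
            ≤⟨ proj₂ (proj₂ (nextChild a P v)) ⟩
          k ∎
          where open ≤-Reasoning

        exposed-next : length (exposed P′ (phaseEnd (suc a))) ≤ k + q * suc k
        exposed-next =
          ≤-trans (length-exposed-+ P′ (suc end) q) (+-monoˡ-≤ (q * suc k) exposed-first)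

      grow : ∀ {a} → Σ (Path m) (Viable a) → Σ (Path m) (Viable (suc a))
      grow {a} (P , v) = P ∷ʳ proj₁ (nextChild a P v) , viable-∷ʳ a P v

      prefix : (a : ℕ) → Σ (Path m) (Viable a)
      prefix zero    = [] , viable-[]
      prefix (suc a) = grow (prefix a)

      prefix-+ : ∀ d a → ∃ λ rest → proj₁ (prefix (d + a)) ≡ proj₁ (prefix a) ++ rest
      prefix-+ zero    a = [] , sym (++-identityʳ _)
      prefix-+ (suc d) a with prefix-+ d a
      ... | rest , grown =
        rest ++ [ new ] , trans (cong (_∷ʳ new) grown) (++-assoc (proj₁ (prefix a)) rest [ new ])
        where
        new = proj₁ (nextChild (d + a) (proj₁ (prefix (d + a))) (proj₂ (prefix (d + a))))

      robberPath : Path m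
      robberPath = proj₁ (prefix h)

      robberPath≤h : length robberPath ≤ h
      robberPath≤h = ≤-reflexive (proj₁ (proj₂ (prefix h)))

      take-robberPath : ∀ a → a ≤ h → take a robberPath ≡ proj₁ (prefix a)
      take-robberPath a a≤h with prefix-+ (h ∸ a) a
      ... | rest , grown = begin
        take a robberPath                   ≡⟨ cong (take a ∘ proj₁ ∘ prefix) (sym (m∸n+n≡m a≤h)) ⟩
        take a (proj₁ (prefix (h ∸ a + a))) ≡⟨ cong (take a) grown ⟩
        take a (Pa ++ rest)                 ≡⟨ cong (λ n → take n (Pa ++ rest)) (sym Pa≡a) ⟩
        take (length Pa) (Pa ++ rest)       ≡⟨ take-length-++ Pa rest ⟩
        Pa                                  ∎
        where
        open ≡-Reasoning
        Pa = proj₁ (prefix a)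
        Pa≡a = proj₁ (proj₂ (prefix a))

      robberWalk : ℕ → TVertex m h
      robberWalk = walkAlong robberPath robberPath≤h

      two-unexposed-children : ∀ a P (v : Viable a P) {R} → R ≤ phaseEnd a →
        let y = proj₁ (nextChild a P v) in y ∉ exposed P R × ∃ λ z → z ≢ y × z ∉ exposed P R
      two-unexposed-children a P v {R} R≤end =
        ∉-exposed-mono P R≤end (proj₁ (proj₂ (nextChild a P v))) ,
        ∃∉-≢ (exposed P R) (proj₁ (nextChild a P v))
             (≤-trans (s≤s (s≤s (length-exposed-mono P R≤end))) (proj₂ v))

      -- A decoy that took another unexposed child at the start of the current phase has made
      -- the same observations, yet stands elsewhere.
      evades : ∀ r → suc (suc r) ≤ h * suc q → ¬ CapturedAt σ robberWalk r
      evades r early captured = z≢y (∷ʳ-injectiveʳ P P (begin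
          P ∷ʳ z                    ≡⟨ take-all (level r) _ (≤-reflexive length-decoy) ⟨
          take (level r) (P ∷ʳ z)
            ≡⟨ cong proj₁ (captured decoy (walkAlong-isWalk (P ∷ʳ z) decoy≤h) same-view) ⟩
          take (level r) robberPath ≡⟨ take-robberPath (level r) a<h ⟩
          P ∷ʳ y                    ∎))
        where
        open ≡-Reasoning
        a = phase r
        P = proj₁ (prefix a)
        v = proj₂ (prefix a)
        y = proj₁ (nextChild a P v)
        children = two-unexposed-children a P v (<-phaseEnd-phase r)
        z = proj₁ (proj₂ children)
        z≢y = proj₁ (proj₂ (proj₂ children))
        z∉ = proj₂ (proj₂ (proj₂ children))
        a<h : a < h
        a<h = phase<height h early
        length-decoy : length (P ∷ʳ z) ≡ level r
        length-decoy = trans (length-∷ʳ P z) (cong suc (proj₁ v))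
        decoy≤h : length (P ∷ʳ z) ≤ h
        decoy≤h = ≤-trans (≤-reflexive length-decoy) a<h
        decoy = walkAlong (P ∷ʳ z) decoy≤h
        on-robberPath : ∀ r' → r' < suc r → take (level r') (P ∷ʳ y) ≡ take (level r') robberPath
        on-robberPath r' r'≤r = trans (cong (take (level r')) (sym (take-robberPath (level r) a<h)))
                                     (take-take-≤ robberPath (s≤s (phase-mono (≤-pred r'≤r))))
        same-view : hist σ decoy (suc r) ≡ hist σ robberWalk (suc r)
        same-view = begin
          hist σ decoy (suc r)             ≡⟨ hist-walkAlong (P ∷ʳ z) decoy≤h (suc r) ⟩
          historyAlong (P ∷ʳ z) (suc r)    ≡⟨ historyAlong-unexposed P z (suc r) z∉ ⟩
          blindHistory P (suc r)           ≡⟨ historyAlong-unexposed P y (suc r) (proj₁ children) ⟨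
          historyAlong (P ∷ʳ y) (suc r)
            ≡⟨ historyAlong-cong (P ∷ʳ y) robberPath (suc r) on-robberPath ⟩
          historyAlong robberPath (suc r)  ≡⟨ hist-walkAlong robberPath robberPath≤h (suc r) ⟨
          hist σ robberWalk (suc r)        ∎

open Evasion using (walkAlong-isWalk; robberWalk; evades)

capture-time-bound : ∀ {m h k q t} → suc (suc q * suc k) ≤ m →
  TreeCanCaptureWithin m h (suc k) t → h * suc q ≤ t
capture-time-bound {k = k} {q} room (σ , captures)
  with captures (robberWalk σ room) (walkAlong-isWalk {k = k} {q} _ _)
... | r , r<t , captured = ≤-trans (≤-pred (≰⇒> (λ early → evades σ room r early captured))) r<t

mainTheorem7 : (m h k : ℕ) → .{{_ : NonZero k}} → 1 ≤ m → 1 ≤ h → 2 ≤ k →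
    ∀ t → TreeCanCaptureWithin m h k t → h * ((m ∸ 1) / k) ≤ t
mainTheorem7 (suc m) h k@(suc (suc _)) _ _ (s≤s (s≤s _)) t capture with m / k | m/n*n≤m m k
... | zero  | _    = ≤-trans (≤-reflexive (*-zeroʳ h)) z≤n
... | suc q | room = capture-time-bound (s≤s room) capture
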